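{- If $n\ge 4$ is an even integer, then $\chi(Q_{n}^{[\natural n-2]})\le \chi(J(n,n/2,1))+2$.
   Context: $Q_n^{[\natural p]}$ is the graph on $\{0,1\}^n$ in which two vertices are adjacent iff they differ in exactly $p$ coordinates. For integers $i\le k\le n$, the generalized Johnson graph $J(n,k,i)$ has vertex set $\{A\subseteq\{1,\ldots,n\}: |A|=k\}$ and edge set $\{AB: |A\cap B|=i\}$. $\chi$ denotes the chromatic number. -}

module Defs where

open import Data.Nat using (ℕ; zero; suc; _+_; _∸_; _*_)
open import Data.Bool using (Bool; true; false; _xor_)
open import Data.Vec using (Vec; []; _∷_; zipWith; count)
open import Data.Fin using (Fin)
open import Data.Fin.Subset using (Subset; ∣_∣; _∩_)
open import Data.Product using (Σ; _×_; proj₁)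
open import Data.Empty using (⊥)
open import Relation.Binary.PropositionalEquality using (_≡_)

record Graph : Set₁ where
  field
    V   : Set
    Adj : V → V → Set

open Graph public

ProperColouring : (G : Graph) (k : ℕ) → (V G → Fin k) → Set
ProperColouring G k c = ∀ u v → Adj G u v → c u ≡ c v → ⊥

Colourable : Graph → ℕ → Set
Colourable G k = Σ (V G → Fin k) (ProperColouring G k)

hamming : ∀ {n} → Vec Bool n → Vec Bool n → ℕ
hamming [] [] = 0
hamming (true ∷ xs) (false ∷ ys) = suc (hamming xs ys)
hamming (false ∷ xs) (true ∷ ys) = suc (hamming xs ys)
hamming (_ ∷ xs) (_ ∷ ys) = hamming xs ys

Qnat : ℕ → ℕ → Graph
Qnat n p = record { V = Vec Bool n ; Adj = λ x y → hamming x y ≡ p }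

J : ℕ → ℕ → ℕ → Graph
J n k i = record
  { V   = Σ (Subset n) (λ A → ∣ A ∣ ≡ k)
  ; Adj = λ A B → ∣ proj₁ A ∩ proj₁ B ∣ ≡ i }

module Submission where

-- Adjacent words x, y of length 2m satisfy |x| + |y| + 2 = 2(|x ∩ y| + m) with |x ∩ y| ≤ 2.
-- So their weights have equal parity, and flipping the first letter of every word whose weight
-- has the parity of m + 1 is a homomorphism onto the words of weight ≡ m (mod 2). Among these,
-- two words of weight ≤ m − 2, or two of weight ≥ m + 2, are never adjacent, while adjacent
-- words of weight m meet in exactly one position, i.e. are adjacent in J(2m, m, 1). Hence the
-- middle layer takes a colouring of J(2m, m, 1), and the lower and upper layers one new colour each.

open import Defs
open import Data.Nat using (ℕ; _+_; _*_; _≤_; _∸_)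
open import Data.Nat using (suc; _<_; z≤n; s≤s; parity)
open import Data.Nat.Properties
open import Data.Nat.Solver using (module +-*-Solver)
open +-*-Solver using (solve; _:+_; _:*_; _:=_; con)
open import Data.Bool using (Bool; true; false; not)
open import Data.Vec using (Vec; []; _∷_)
open import Data.Fin using (Fin; _↑ˡ_; _↑ʳ_; splitAt)
import Data.Fin as Fin
open import Data.Fin.Properties using (splitAt-↑ˡ; splitAt-↑ʳ; ↑ˡ-injective; ↑ʳ-injective)
open import Data.Fin.Subset using (∣_∣; _∩_)
open import Data.Parity.Base as ℙ using (Parity; 0ℙ; 1ℙ; _⁻¹)
open import Data.Parity.Properties as ℙ using (p≢p⁻¹; +-homo-+; *-homo-*; suc-homo-⁻¹; ⁻¹-selfInverse; p+p≡0ℙ)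
open import Data.Product using (Σ; _,_; proj₁)
open import Function using (_∘_; case_of_)
open import Relation.Binary using (tri<; tri≈; tri>)
open import Relation.Binary.PropositionalEquality hiding (J)
open import Relation.Nullary using (yes; no; contradiction)

Homomorphism : (G H : Graph) → (V G → V H) → Set
Homomorphism G H f = ∀ u v → Adj G u v → Adj H (f u) (f v)

ProperColouring-∘ : ∀ {G H k} (f : V G → V H) {c : V H → Fin k} →
  Homomorphism G H f → ProperColouring H k c → ProperColouring G k (c ∘ f)
ProperColouring-∘ f hom proper u v uv = proper (f u) (f v) (hom u v uv)

Induced : (G : Graph) → (V G → Set) → Graph
Induced G P = record { V = Σ (V G) P ; Adj = λ u v → Adj G (proj₁ u) (proj₁ v) }

∣x∣+∣y∣≡2∣x∩y∣+hamming : ∀ {n} (x y : Vec Bool n) → ∣ x ∣ + ∣ y ∣ ≡ 2 * ∣ x ∩ y ∣ + hamming x y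
∣x∣+∣y∣≡2∣x∩y∣+hamming [] [] = refl
∣x∣+∣y∣≡2∣x∩y∣+hamming (true ∷ xs) (true ∷ ys) = begin
  suc ∣ xs ∣ + suc ∣ ys ∣          ≡⟨ cong suc (+-suc ∣ xs ∣ ∣ ys ∣) ⟩
  2 + (∣ xs ∣ + ∣ ys ∣)            ≡⟨ cong (2 +_) (∣x∣+∣y∣≡2∣x∩y∣+hamming xs ys) ⟩
  2 + (2 * ∣ xs ∩ ys ∣ + hamming xs ys) ≡⟨ cong (_+ hamming xs ys) (*-distribˡ-+ 2 1 ∣ xs ∩ ys ∣) ⟨
  2 * suc ∣ xs ∩ ys ∣ + hamming xs ys ∎
  where open ≡-Reasoning
∣x∣+∣y∣≡2∣x∩y∣+hamming (true ∷ xs) (false ∷ ys) =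
  trans (cong suc (∣x∣+∣y∣≡2∣x∩y∣+hamming xs ys)) (sym (+-suc _ _))
∣x∣+∣y∣≡2∣x∩y∣+hamming (false ∷ xs) (true ∷ ys) =
  trans (+-suc ∣ xs ∣ ∣ ys ∣) (trans (cong suc (∣x∣+∣y∣≡2∣x∩y∣+hamming xs ys)) (sym (+-suc _ _)))
∣x∣+∣y∣≡2∣x∩y∣+hamming (false ∷ xs) (false ∷ ys) = ∣x∣+∣y∣≡2∣x∩y∣+hamming xs ys

∣x∩y∣+hamming≤n : ∀ {n} (x y : Vec Bool n) → ∣ x ∩ y ∣ + hamming x y ≤ n
∣x∩y∣+hamming≤n [] [] = z≤n
∣x∩y∣+hamming≤n (true ∷ xs) (true ∷ ys) = s≤s (∣x∩y∣+hamming≤n xs ys)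
∣x∩y∣+hamming≤n {suc n} (true ∷ xs) (false ∷ ys) =
  subst (_≤ suc n) (sym (+-suc _ _)) (s≤s (∣x∩y∣+hamming≤n xs ys))
∣x∩y∣+hamming≤n {suc n} (false ∷ xs) (true ∷ ys) =
  subst (_≤ suc n) (sym (+-suc _ _)) (s≤s (∣x∩y∣+hamming≤n xs ys))
∣x∩y∣+hamming≤n (false ∷ xs) (false ∷ ys) = m≤n⇒m≤1+n (∣x∩y∣+hamming≤n xs ys)

flipHead : ∀ {n} → Vec Bool (suc n) → Vec Bool (suc n)
flipHead (b ∷ xs) = not b ∷ xs

hamming-flipHead : ∀ {n} (x y : Vec Bool (suc n)) → hamming (flipHead x) (flipHead y) ≡ hamming x y
hamming-flipHead (true ∷ xs) (true ∷ ys) = refl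
hamming-flipHead (true ∷ xs) (false ∷ ys) = refl
hamming-flipHead (false ∷ xs) (true ∷ ys) = refl
hamming-flipHead (false ∷ xs) (false ∷ ys) = refl

parity-suc : ∀ n → parity (suc n) ≡ parity n ⁻¹
parity-suc n = sym (⁻¹-selfInverse (suc-homo-⁻¹ n))

parity-∣flipHead∣ : ∀ {n} (x : Vec Bool (suc n)) → parity ∣ flipHead x ∣ ≡ parity ∣ x ∣ ⁻¹
parity-∣flipHead∣ (true ∷ xs) = sym (suc-homo-⁻¹ ∣ xs ∣)
parity-∣flipHead∣ (false ∷ xs) = parity-suc ∣ xs ∣

p≢q⇒p⁻¹≡q : ∀ {p q : Parity} → p ≢ q → p ⁻¹ ≡ q
p≢q⇒p⁻¹≡q {0ℙ} {0ℙ} p≢q = contradiction refl p≢q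
p≢q⇒p⁻¹≡q {0ℙ} {1ℙ} _ = refl
p≢q⇒p⁻¹≡q {1ℙ} {0ℙ} _ = refl
p≢q⇒p⁻¹≡q {1ℙ} {1ℙ} p≢q = contradiction refl p≢q

parity-+≡0ℙ⇒parity≡ : ∀ u v → parity (u + v) ≡ 0ℙ → parity u ≡ parity v
parity-+≡0ℙ⇒parity≡ u v even = ℙ.+-cancelʳ-≡ (parity v) (parity u) (parity v)
  (trans (sym (+-homo-+ u v)) (trans even (sym (p+p≡0ℙ (parity v)))))

parity-+2 : ∀ n → parity (n + 2) ≡ parity n
parity-+2 n = trans (+-homo-+ n 2) (ℙ.+-identityʳ (parity n))

parity≡∧<⇒2+≤ : ∀ {u v} → parity u ≡ parity v → u < v → 2 + u ≤ v
parity≡∧<⇒2+≤ {u} {v} same u<v = ≤∧≢⇒< u<v λ 1+u≡v →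
  p≢p⁻¹ (parity v) (trans (sym (cong parity 1+u≡v)) (trans (parity-suc u) (cong _⁻¹ same)))

lower-layers-independent : ∀ {a m u v} → 2 + u ≤ m → 2 + v ≤ m → u + v + 2 ≢ 2 * (a + m)
lower-layers-independent {a} {m} {u} {v} u<m v<m eq = <-irrefl refl (begin-strict
  2 * m             ≤⟨ *-monoʳ-≤ 2 (m≤n+m m a) ⟩
  2 * (a + m)       ≡⟨ eq ⟨
  u + v + 2         <⟨ +-monoʳ-< (u + v) (s≤s (s≤s (s≤s z≤n))) ⟩
  u + v + 4         ≡⟨ solve 2 (λ u v → u :+ v :+ con 4 := (con 2 :+ u) :+ (con 2 :+ v)) refl u v ⟩
  (2 + u) + (2 + v) ≤⟨ +-mono-≤ u<m v<m ⟩
  m + m             ≡⟨ cong (m +_) (+-identityʳ m) ⟨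
  2 * m             ∎)
  where open ≤-Reasoning

upper-layers-independent : ∀ {a m u v} → a ≤ 2 → 2 + m ≤ u → 2 + m ≤ v → u + v + 2 ≢ 2 * (a + m)
upper-layers-independent {a} {m} {u} {v} a≤2 m<u m<v eq = <-irrefl refl (begin-strict
  2 * (a + m)             ≤⟨ *-monoʳ-≤ 2 (+-monoˡ-≤ m a≤2) ⟩
  2 * (2 + m)             ≡⟨ cong ((2 + m) +_) (+-identityʳ (2 + m)) ⟩
  (2 + m) + (2 + m)       <⟨ m<m+n ((2 + m) + (2 + m)) (s≤s z≤n) ⟩
  (2 + m) + (2 + m) + 2   ≤⟨ +-monoˡ-≤ 2 (+-mono-≤ m<u m<v) ⟩
  u + v + 2               ≡⟨ eq ⟩
  2 * (a + m)             ∎)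
  where open ≤-Reasoning

middle-layer-intersection : ∀ {a m} → m + m + 2 ≡ 2 * (a + m) → a ≡ 1
middle-layer-intersection {a} {m} eq =
  +-cancelʳ-≡ m a 1 (*-cancelˡ-≡ (a + m) (1 + m) 2 (trans (sym eq) m+m+2≡2[1+m]))
  where
  m+m+2≡2[1+m] : m + m + 2 ≡ 2 * (1 + m)
  m+m+2≡2[1+m] = solve 1 (λ m → m :+ m :+ con 2 := con 2 :* (con 1 :+ m)) refl m

weight-sum : ∀ {n} (x y : Vec Bool n) → hamming x y + 2 ≡ n → ∣ x ∣ + ∣ y ∣ + 2 ≡ 2 * ∣ x ∩ y ∣ + n
weight-sum {n} x y h+2≡n = begin
  ∣ x ∣ + ∣ y ∣ + 2                      ≡⟨ cong (_+ 2) (∣x∣+∣y∣≡2∣x∩y∣+hamming x y) ⟩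
  2 * ∣ x ∩ y ∣ + hamming x y + 2        ≡⟨ +-assoc (2 * ∣ x ∩ y ∣) (hamming x y) 2 ⟩
  2 * ∣ x ∩ y ∣ + (hamming x y + 2)      ≡⟨ cong (2 * ∣ x ∩ y ∣ +_) h+2≡n ⟩
  2 * ∣ x ∩ y ∣ + n                      ∎
  where open ≡-Reasoning

∣x∩y∣≤2 : ∀ {n} (x y : Vec Bool n) → hamming x y + 2 ≡ n → ∣ x ∩ y ∣ ≤ 2
∣x∩y∣≤2 x y h+2≡n = +-cancelʳ-≤ (hamming x y) ∣ x ∩ y ∣ 2
  (subst (∣ x ∩ y ∣ + hamming x y ≤_) (trans (sym h+2≡n) (+-comm (hamming x y) 2)) (∣x∩y∣+hamming≤n x y))

↑ˡ≢↑ʳ : ∀ {m n} (i : Fin m) (j : Fin n) → i ↑ˡ n ≢ m ↑ʳ j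
↑ˡ≢↑ʳ {m} {n} i j eq
  with () ← trans (sym (splitAt-↑ˡ m i n)) (trans (cong (splitAt m) eq) (splitAt-↑ʳ m n j))

-- m is taken in the form 2 + k so that words of length 2 * m are visibly nonempty, as flipHead needs.
module ViaJohnson (k c : ℕ) where

  m : ℕ
  m = 2 + k

  Q : Graph
  Q = Qnat (2 * m) (2 * m ∸ 2)

  Balanced : V Q → Set
  Balanced x = parity ∣ x ∣ ≡ parity m

  module Adjacent (x y : V Q) (adj : Adj Q x y) where

    hamming+2 : hamming x y + 2 ≡ 2 * m
    hamming+2 = trans (cong (_+ 2) adj) (m∸n+n≡m (s≤s (s≤s z≤n)))

    weights : ∣ x ∣ + ∣ y ∣ + 2 ≡ 2 * (∣ x ∩ y ∣ + m)
    weights = trans (weight-sum x y hamming+2) (sym (*-distribˡ-+ 2 ∣ x ∩ y ∣ m))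

    parity≡ : parity ∣ x ∣ ≡ parity ∣ y ∣
    parity≡ = parity-+≡0ℙ⇒parity≡ ∣ x ∣ ∣ y ∣
      (trans (sym (parity-+2 (∣ x ∣ + ∣ y ∣))) (trans (cong parity weights) (*-homo-* 2 (∣ x ∩ y ∣ + m))))

  balance : V Q → V (Induced Q Balanced)
  balance x with parity ∣ x ∣ ℙ.≟ parity m
  ... | yes balanced = x , balanced
  ... | no unbalanced = flipHead x , trans (parity-∣flipHead∣ x) (p≢q⇒p⁻¹≡q unbalanced)

  balance-homomorphism : Homomorphism Q (Induced Q Balanced) balance
  balance-homomorphism x y adj with parity ∣ x ∣ ℙ.≟ parity m | parity ∣ y ∣ ℙ.≟ parity m
  ... | yes _ | yes _ = adj
  ... | no _ | no _ = trans (hamming-flipHead x y) adj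
  ... | yes bx | no ¬by = contradiction (trans (sym (Adjacent.parity≡ x y adj)) bx) ¬by
  ... | no ¬bx | yes by = contradiction (trans (Adjacent.parity≡ x y adj) by) ¬bx

  module _ (χ : V (J (2 * m) m 1) → Fin c) (proper : ProperColouring (J (2 * m) m 1) c χ) where

    layerColour : V (Induced Q Balanced) → Fin (c + 2)
    layerColour (x , _) with <-cmp ∣ x ∣ m
    ... | tri< _ _ _ = c ↑ʳ Fin.zero
    ... | tri≈ _ x∈J _ = χ (x , x∈J) ↑ˡ 2
    ... | tri> _ _ _ = c ↑ʳ Fin.suc Fin.zero

    layerColour-proper : ProperColouring (Induced Q Balanced) (c + 2) layerColour
    layerColour-proper (x , bx) (y , by) adj with <-cmp ∣ x ∣ m | <-cmp ∣ y ∣ m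
    ... | tri< x<m _ _ | tri< y<m _ _ = λ _ →
      lower-layers-independent {a = ∣ x ∩ y ∣} (parity≡∧<⇒2+≤ bx x<m) (parity≡∧<⇒2+≤ by y<m)
        (Adjacent.weights x y adj)
    ... | tri> _ _ m<x | tri> _ _ m<y = λ _ →
      upper-layers-independent (∣x∩y∣≤2 x y (Adjacent.hamming+2 x y adj))
        (parity≡∧<⇒2+≤ (sym bx) m<x) (parity≡∧<⇒2+≤ (sym by) m<y) (Adjacent.weights x y adj)
    ... | tri≈ _ x∈J _ | tri≈ _ y∈J _ = λ eq →
      proper (x , x∈J) (y , y∈J)
        (middle-layer-intersection {m = m}
          (trans (cong₂ (λ u v → u + v + 2) (sym x∈J) (sym y∈J)) (Adjacent.weights x y adj)))
        (↑ˡ-injective 2 _ _ eq)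
    ... | tri< _ _ _ | tri> _ _ _ = λ eq → case ↑ʳ-injective c _ _ eq of λ ()
    ... | tri> _ _ _ | tri< _ _ _ = λ eq → case ↑ʳ-injective c _ _ eq of λ ()
    ... | tri≈ _ _ _ | tri< _ _ _ = ↑ˡ≢↑ʳ _ _
    ... | tri≈ _ _ _ | tri> _ _ _ = ↑ˡ≢↑ʳ _ _
    ... | tri< _ _ _ | tri≈ _ _ _ = ↑ˡ≢↑ʳ _ _ ∘ sym
    ... | tri> _ _ _ | tri≈ _ _ _ = ↑ˡ≢↑ʳ _ _ ∘ sym

  colourable : Colourable (J (2 * m) m 1) c → Colourable Q (c + 2)
  colourable (χ , proper) =
    layerColour χ proper ∘ balance ,
    ProperColouring-∘ balance balance-homomorphism (layerColour-proper χ proper)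

theorem4p15 : (m : ℕ) → 2 ≤ m → (c : ℕ) →
    Colourable (J (2 * m) m 1) c → Colourable (Qnat (2 * m) (2 * m ∸ 2)) (c + 2)
theorem4p15 (suc (suc k)) _ c = ViaJohnson.colourable k c
theorem4p15 1 (s≤s ())
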